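{- For every buyback factor $0\le f\le\frac13$, the deterministic integral algorithm with penalty scalar $\tau=\frac{1+f}{1-f}$ for edge-weighted online matching with buyback has competitive ratio at most $\frac{2}{1-f}$.
   Context: Edge-weighted online matching with buyback, deterministic integral setting: offline nodes $V$, each of capacity $1$, known upfront; online nodes $i=1,\dots,T$ arrive one at a time, each revealing nonnegative weights $w_{ij}$. Upon arrival of $i$ the algorithm either leaves it unmatched or matches it to one offline node $j$, buying back $j$'s current partner $i'$ (if any) entirely, which loses reward $w_{i'j}$ and costs an extra $f\,w_{i'j}$; matching $i$ to $j$ yields reward $w_{ij}$. Profit = reward of final matching minus buyback costs; $\mathrm{OPT}$ = maximum weight bipartite matching; competitive ratio = $\sup_I\mathrm{OPT}(I)/\mathrm{ALG}(I)$. Algorithm with penalty scalar $\tau$: maintain $\underline w_j$ = weight of the edge currently matched at $j$ ($0$ if none). For each arriving $i$: if some $j$ has $\tau\underline w_j<w_{ij}$, let $j^*\in\arg\max_j(w_{ij}-\tau\underline w_j)$, buy back $j^*$ from its current partner, match $i$ to $j^*$, set $\underline w_{j^*}\gets w_{ij^*}$; otherwise leave $i$ unmatched.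
   Formalization: The buyback factor f and the edge weights $w_{ij}$ are rational. -}

module Defs where

open import Data.Nat using (ℕ; zero; suc; _<_)
import Data.Fin as Fin
open import Data.Fin using (Fin; fromℕ<; _≟_)
open import Relation.Nullary using (yes; no)
open import Data.Integer using (+_)
open import Data.Rational using (ℚ; 0ℚ; 1ℚ; _+_; _*_; _-_; -_; _÷_; _/_; _≤_; NonZero; Positive; positive; _<?_)
  renaming (_<_ to _<ℚ_)
open import Data.Rational.Properties using (≤-<-trans; <-≤-trans; +-monoˡ-<; +-inverseʳ; pos⇒nonZero)
open import Data.Product using (∃)
open import Data.Maybe using (Maybe; just; nothing)
open import Relation.Binary.PropositionalEquality using (_≡_; _≢_; sym; subst)
open import Relation.Nullary.Decidable using (toWitness)

Σℚ : (n : ℕ) → (Fin n → ℚ) → ℚ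
Σℚ zero    g = 0ℚ
Σℚ (suc n) g = g Fin.zero + Σℚ n (λ k → g (Fin.suc k))

one-third : ℚ
one-third = (+ 1) / 3

1-f>0 : (f : ℚ) → f ≤ one-third → 0ℚ <ℚ (1ℚ - f)
1-f>0 f f≤ = subst (_<ℚ (1ℚ - f)) (+-inverseʳ f)
  (+-monoˡ-< (- f) (≤-<-trans f≤ (toWitness {a? = one-third <? 1ℚ} _)))

1-f-nonZero : (f : ℚ) → f ≤ one-third → NonZero (1ℚ - f)
1-f-nonZero f f≤ = pos⇒nonZero (1ℚ - f) {{positive (1-f>0 f f≤)}}

penalty : (f : ℚ) → f ≤ one-third → ℚ
penalty f f≤ = (1ℚ + f) ÷ (1ℚ - f)
  where instance _ = 1-f-nonZero f f≤

ratio : (f : ℚ) → f ≤ one-third → ℚ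
ratio f f≤ = (1ℚ + 1ℚ) ÷ (1ℚ - f)
  where instance _ = 1-f-nonZero f f≤

-- Instances: n offline nodes (capacity 1), T online nodes arriving in
-- order 0,1,…,T-1, weights w i j ≥ 0.

Weights : ℕ → ℕ → Set
Weights T n = Fin T → Fin n → ℚ

NonNegWeights : ∀ {T n} → Weights T n → Set
NonNegWeights {T} {n} w = ∀ (i : Fin T) (j : Fin n) → 0ℚ ≤ w i j

record Matching (T n : ℕ) : Set where
  field
    partner   : Fin T → Maybe (Fin n)
    injective : ∀ (i i' : Fin T) (j : Fin n) →
                partner i ≡ just j → partner i' ≡ just j → i ≡ i'

edgeWeight : ∀ {T n} → Weights T n → Fin T → Maybe (Fin n) → ℚ
edgeWeight w i nothing  = 0ℚ
edgeWeight w i (just j) = w i j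

matchingWeight : ∀ {T n} → Weights T n → Matching T n → ℚ
matchingWeight {T} w M = Σℚ T (λ i → edgeWeight w i (Matching.partner M i))

-- State: wl j = weight of the edge currently matched at j (0 if none),
-- together with the total buyback cost paid so far.
-- Exec τ w k wl c : some run of the algorithm (with an arbitrary choice
-- of j* among the maximisers) on the first k arrivals ends with
-- current weights wl and accumulated buyback cost c.

update : ∀ {n} → (Fin n → ℚ) → Fin n → ℚ → (Fin n → ℚ)
update wl j x k with j ≟ k
... | yes _ = x
... | no  _ = wl k

data Exec {T n : ℕ} (τ f : ℚ) (w : Weights T n) :
          (k : ℕ) → (Fin n → ℚ) → ℚ → Set where
  start : Exec τ f w 0 (λ _ → 0ℚ) 0ℚ
  skip  : ∀ {k wl c} → Exec τ f w k wl c → (k<T : k < T) →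
          (∀ j → w (fromℕ< k<T) j ≤ τ * wl j) →
          Exec τ f w (suc k) wl c
  -- some j with τ·wl j < w i j : match i to a maximiser j* of
  -- w i j − τ·wl j, buying back j*'s current edge (cost f·wl j*)
  match : ∀ {k wl c} → Exec τ f w k wl c → (k<T : k < T) → (j* : Fin n) →
          (∃ λ j → τ * wl j <ℚ w (fromℕ< k<T) j) →
          (∀ j → w (fromℕ< k<T) j - τ * wl j ≤ w (fromℕ< k<T) j* - τ * wl j*) →
          Exec τ f w (suc k) (update wl j* (w (fromℕ< k<T) j*)) (c + f * wl j*)

profit : ∀ {n} → (Fin n → ℚ) → ℚ → ℚ
profit {n} wl c = Σℚ n wl - c

-- With κ = 2/(1-f) one has τ = 1 + κf and κ = 1 + τ.  Let Φ = Σⱼ w̲ⱼ - κ·(buyback cost so far).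
-- Each arrival i raises Φ by a gain g ≥ 0 (0 if i is left unmatched, w_ij* - τ·w̲_j* if it is
-- matched to j*), and by the rule of the algorithm w_ij ≤ τ·w̲ⱼ + g for every j, with w̲ read
-- after the step.  As τ·w̲ⱼ never decreases, charging the optimal edge of i to its endpoint j
-- (τ·w̲ⱼ at that moment, at most once per j since OPT is a matching) gives
-- OPT ≤ Φ + τ·Σⱼ w̲ⱼ = κ·profit at the end.

{-# OPTIONS --safe #-}
module Submission where

open import Defs
open import Algebra.Bundles using (CommutativeRing)
open import Data.Empty using (⊥-elim)
open import Data.Fin using (Fin; zero; suc; toℕ; fromℕ<; _≟_)
open import Data.Fin.Properties using (toℕ<n; toℕ-fromℕ<; punchInᵢ≢i)
open import Data.Maybe using (just; nothing)
open import Data.Nat using (ℕ; zero; suc; s≤s) renaming (_<_ to _<ℕ_)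
import Data.Nat.Properties as ℕ
open import Data.Product using (∃; _,_)
open import Data.Rational
  using (ℚ; 0ℚ; 1ℚ; _+_; _*_; _-_; -_; 1/_; _≤_; NonZero; nonNegative; positive)
  renaming (_<_ to _<ℚ_)
import Data.Rational.Properties as ℚ
open import Data.Rational.Solver using (module +-*-Solver)
open import Data.Vec.Functional using (Vector; removeAt)
open import Function using (_∘_)
open import Relation.Binary.PropositionalEquality
open import Relation.Nullary using (yes; no)

open import Algebra.Properties.Semiring.Sum (CommutativeRing.semiring ℚ.+-*-commutativeRing)
  using (sum; sum-cong-≗; sum-replicate-zero; sum-remove; *-distribˡ-sum)
open +-*-Solver using (solve; _:+_; _:-_; _:*_; _:=_; con)

p≤p+q : ∀ p {q} → 0ℚ ≤ q → p ≤ p + q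
p≤p+q p {q} 0≤q = subst (_≤ p + q) (ℚ.+-identityʳ p) (ℚ.+-monoʳ-≤ p 0≤q)

p+[q-p]≡q : ∀ p q → p + (q - p) ≡ q
p+[q-p]≡q = solve 2 (λ p q → p :+ (q :- p) := q) refl

p≤q⇒0≤q-p : ∀ {p q} → p ≤ q → 0ℚ ≤ q - p
p≤q⇒0≤q-p {p} {q} p≤q = subst (_≤ q - p) (ℚ.+-inverseʳ p) (ℚ.+-monoˡ-≤ (- p) p≤q)

0≤q-p⇒p≤q : ∀ {p q} → 0ℚ ≤ q - p → p ≤ q
0≤q-p⇒p≤q {p} {q} 0≤q-p = subst (p ≤_) (p+[q-p]≡q p q) (p≤p+q p 0≤q-p)

p-q≤r⇒p≤q+r : ∀ {p q r} → p - q ≤ r → p ≤ q + r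
p-q≤r⇒p≤q+r {p} {q} {r} p-q≤r = subst (_≤ q + r) (p+[q-p]≡q q p) (ℚ.+-monoʳ-≤ q p-q≤r)

0≤p*q : ∀ {p q} → 0ℚ ≤ p → 0ℚ ≤ q → 0ℚ ≤ p * q
0≤p*q {p} {q} 0≤p 0≤q = ℚ.nonNegative⁻¹ (p * q)
  {{ℚ.nonNeg*nonNeg⇒nonNeg p {{nonNegative 0≤p}} q {{nonNegative 0≤q}}}}

Σℚ≡sum : ∀ n (g : Vector ℚ n) → Σℚ n g ≡ sum g
Σℚ≡sum zero    g = refl
Σℚ≡sum (suc n) g = cong (g zero +_) (Σℚ≡sum n (g ∘ suc))

sum-mono-≤ : ∀ {n} {g h : Vector ℚ n} → (∀ i → g i ≤ h i) → sum g ≤ sum h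
sum-mono-≤ {zero}  _   = ℚ.≤-refl
sum-mono-≤ {suc n} g≤h = ℚ.+-mono-≤ (g≤h zero) (sum-mono-≤ (g≤h ∘ suc))

update-≡ : ∀ {n} (g : Vector ℚ n) j x → update g j x j ≡ x
update-≡ g j x with j ≟ j
... | yes _   = refl
... | no  j≢j = ⊥-elim (j≢j refl)

update-≢ : ∀ {n} (g : Vector ℚ n) {j k} x → j ≢ k → update g j x k ≡ g k
update-≢ g {j} {k} x j≢k with j ≟ k
... | yes j≡k = ⊥-elim (j≢k j≡k)
... | no  _   = refl

update-elim : ∀ {n} (P : Fin n → ℚ → Set) (g : Vector ℚ n) {j x} →
              P j x → (∀ k → j ≢ k → P k (g k)) → ∀ k → P k (update g j x k)
update-elim P g {j} Pj Pk k with j ≟ k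
... | yes refl = Pj
... | no  j≢k  = Pk k j≢k

sum-update : ∀ {n} (g : Vector ℚ n) j x → sum (update g j x) ≡ sum g + (x - g j)
sum-update {suc n} g j x = begin
  sum (update g j x)                                ≡⟨ sum-remove (update g j x) ⟩
  update g j x j + sum (removeAt (update g j x) j)  ≡⟨ cong₂ _+_ (update-≡ g j x) rest-unchanged ⟩
  x + rest                                          ≡⟨ rearrange x rest (g j) ⟩
  (g j + rest) + (x - g j)                          ≡⟨ cong (_+ (x - g j)) (sum-remove g) ⟨
  sum g + (x - g j)                                 ∎
  where
  open ≡-Reasoning
  rest : ℚ
  rest = sum (removeAt g j)
  rest-unchanged : sum (removeAt (update g j x) j) ≡ rest
  rest-unchanged = sum-cong-≗ (λ k → update-≢ g x (punchInᵢ≢i j k ∘ sym))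
  rearrange : ∀ x r a → x + r ≡ (a + r) + (x - a)
  rearrange = solve 3 (λ x r a → x :+ r := (a :+ r) :+ (x :- a)) refl

prefix : ∀ {T} → ℕ → Vector ℚ T → Vector ℚ T
prefix zero    g i       = 0ℚ
prefix (suc k) g zero    = g zero
prefix (suc k) g (suc i) = prefix k (g ∘ suc) i

prefix-< : ∀ {T k} (g : Vector ℚ T) {i} → toℕ i <ℕ k → prefix k g i ≡ g i
prefix-< {k = suc k} g {zero}  _         = refl
prefix-< {k = suc k} g {suc i} (s≤s i<k) = prefix-< (g ∘ suc) i<k

sum-prefix-zero : ∀ {T} (g : Vector ℚ T) → sum (prefix 0 g) ≡ 0ℚ
sum-prefix-zero {T} _ = sum-replicate-zero T

sum-prefix-suc : ∀ {T k} (g : Vector ℚ T) (k<T : k <ℕ T) →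
                 sum (prefix (suc k) g) ≡ sum (prefix k g) + g (fromℕ< k<T)
sum-prefix-suc {suc T} {zero} g _ = begin
  g zero + sum (prefix 0 (g ∘ suc))  ≡⟨ cong (g zero +_) (sum-prefix-zero (g ∘ suc)) ⟩
  g zero + 0ℚ                        ≡⟨ ℚ.+-comm (g zero) 0ℚ ⟩
  0ℚ + g zero                        ≡⟨ cong (_+ g zero) (sum-prefix-zero g) ⟨
  sum (prefix 0 g) + g zero          ∎
  where open ≡-Reasoning
sum-prefix-suc {suc T} {suc k} g (s≤s k<T) =
  trans (cong (g zero +_) (sum-prefix-suc (g ∘ suc) k<T))
        (sym (ℚ.+-assoc (g zero) (sum (prefix k (g ∘ suc))) (g (suc (fromℕ< k<T)))))

sum-prefix-all : ∀ {T} (g : Vector ℚ T) → sum (prefix T g) ≡ sum g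
sum-prefix-all g = sum-cong-≗ (λ i → prefix-< g (toℕ<n i))

module Analysis (κ f : ℚ) (0≤κf : 0ℚ ≤ κ * f)
                {T n : ℕ} (w : Weights T n) (w≥0 : NonNegWeights w) (M : Matching T n) where

  open Matching M using (partner; injective)

  τ : ℚ
  τ = 1ℚ + κ * f

  p≤τ*p : ∀ {p} → 0ℚ ≤ p → p ≤ τ * p
  p≤τ*p {p} 0≤p = subst (p ≤_) (factor p (κ * f)) (p≤p+q p (0≤p*q 0≤κf 0≤p))
    where
    factor : ∀ p a → p + a * p ≡ (1ℚ + a) * p
    factor = solve 2 (λ p a → p :+ a :* p := (con 1ℚ :+ a) :* p) refl

  opt : Vector ℚ T
  opt i = edgeWeight w i (partner i)

  potential : Vector ℚ n → ℚ → ℚ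
  potential wl c = sum wl - κ * c

  Unused : ℕ → Fin n → Set
  Unused k j = ∀ i → toℕ i <ℕ k → partner i ≢ just j

  -- charge j is τ * wl j as of the arrival of j's partner in M, and 0 before it.
  record Invariant (k : ℕ) (wl : Vector ℚ n) (c : ℚ) : Set where
    field
      charge        : Vector ℚ n
      charge≤       : ∀ j → charge j ≤ τ * wl j
      charge-unused : ∀ j → Unused k j → charge j ≡ 0ℚ
      covers        : sum (prefix k opt) ≤ potential wl c + sum charge

  initial : Invariant 0 (λ _ → 0ℚ) 0ℚ
  initial = record
    { charge        = λ _ → 0ℚ
    ; charge≤       = λ _ → ℚ.≤-reflexive (sym (ℚ.*-zeroʳ τ))
    ; charge-unused = λ _ _ → refl
    ; covers        = ℚ.≤-reflexive (trans (sum-prefix-zero opt) (sym all-zero))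
    }
    where
    all-zero : potential (λ _ → 0ℚ) 0ℚ + sum {n} (λ _ → 0ℚ) ≡ 0ℚ
    all-zero = cong₂ (λ s t → (s - t) + s) (sum-replicate-zero n) (ℚ.*-zeroʳ κ)

  module Step (k : ℕ) (k<T : k <ℕ T) where

    i₀ : Fin T
    i₀ = fromℕ< k<T

    i₀<1+k : toℕ i₀ <ℕ suc k
    i₀<1+k = ℕ.≤-reflexive (cong suc (toℕ-fromℕ< k<T))

    unused-weaken : ∀ {j} → Unused (suc k) j → Unused k j
    unused-weaken unused i i<k = unused i (ℕ.m<n⇒m<1+n i<k)

    unused-partner : ∀ {j} → partner i₀ ≡ just j → Unused k j
    unused-partner p i i<k q =
      ℕ.<-irrefl (toℕ-fromℕ< k<T) (subst (λ i → toℕ i <ℕ k) (injective i i₀ _ q p) i<k)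

    module _ {wl c wl′ c′} (I : Invariant k wl c) (g : ℚ) (0≤g : 0ℚ ≤ g)
             (potential-step : potential wl′ c′ ≡ potential wl c + g)
             (τ*wl-mono : ∀ j → τ * wl j ≤ τ * wl′ j)
             (edges-covered : ∀ j → w i₀ j ≤ τ * wl′ j + g) where

      open Invariant I

      charge≤′ : ∀ j → charge j ≤ τ * wl′ j
      charge≤′ j = ℚ.≤-trans (charge≤ j) (τ*wl-mono j)

      step-unmatched : partner i₀ ≡ nothing → Invariant (suc k) wl′ c′
      step-unmatched p = record
        { charge        = charge
        ; charge≤       = charge≤′
        ; charge-unused = λ j → charge-unused j ∘ unused-weaken
        ; covers        = begin
            sum (prefix (suc k) opt)           ≡⟨ sum-prefix-suc opt k<T ⟩
            sum (prefix k opt) + opt i₀        ≡⟨ cong (λ e → sum (prefix k opt) + edgeWeight w i₀ e) p ⟩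
            sum (prefix k opt) + 0ℚ            ≡⟨ ℚ.+-identityʳ _ ⟩
            sum (prefix k opt)                 ≤⟨ covers ⟩
            potential wl c + sum charge        ≤⟨ ℚ.+-monoˡ-≤ (sum charge) (p≤p+q (potential wl c) 0≤g) ⟩
            (potential wl c + g) + sum charge  ≡⟨ cong (_+ sum charge) potential-step ⟨
            potential wl′ c′ + sum charge      ∎
        }
        where open ℚ.≤-Reasoning

      step-matched : ∀ {j₀} → partner i₀ ≡ just j₀ → Invariant (suc k) wl′ c′
      step-matched {j₀} p = record
        { charge        = charge′
        ; charge≤       = charge′≤
        ; charge-unused = charge′-unused
        ; covers        = begin
            sum (prefix (suc k) opt)                 ≡⟨ sum-prefix-suc opt k<T ⟩
            sum (prefix k opt) + opt i₀              ≡⟨ cong (λ e → sum (prefix k opt) + edgeWeight w i₀ e) p ⟩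
            sum (prefix k opt) + w i₀ j₀             ≤⟨ ℚ.+-mono-≤ covers (edges-covered j₀) ⟩
            (potential wl c + sum charge) + (y + g)  ≡⟨ regroup (potential wl c) (sum charge) y g ⟩
            (potential wl c + g) + (sum charge + y)  ≡⟨ cong₂ _+_ potential-step sum-charge′ ⟨
            potential wl′ c′ + sum charge′           ∎
        }
        where
        open ℚ.≤-Reasoning
        regroup : ∀ Φ s y g → (Φ + s) + (y + g) ≡ (Φ + g) + (s + y)
        regroup = solve 4 (λ Φ s y g → (Φ :+ s) :+ (y :+ g) := (Φ :+ g) :+ (s :+ y)) refl
        y : ℚ
        y = τ * wl′ j₀
        charge′ : Vector ℚ n
        charge′ = update charge j₀ y

        charge′≤ : ∀ j → charge′ j ≤ τ * wl′ j
        charge′≤ = update-elim (λ j v → v ≤ τ * wl′ j) charge {j₀} ℚ.≤-refl (λ j _ → charge≤′ j)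

        charge′-unused : ∀ j → Unused (suc k) j → charge′ j ≡ 0ℚ
        charge′-unused = update-elim (λ j v → Unused (suc k) j → v ≡ 0ℚ) charge {j₀}
          (λ unused → ⊥-elim (unused i₀ i₀<1+k p)) (λ j _ → charge-unused j ∘ unused-weaken)

        sum-charge′ : sum charge′ ≡ sum charge + y
        sum-charge′ = begin-equality
          sum charge′                   ≡⟨ sum-update charge j₀ y ⟩
          sum charge + (y - charge j₀)  ≡⟨ cong (λ z → sum charge + (y - z)) charge-j₀≡0 ⟩
          sum charge + (y - 0ℚ)         ≡⟨ cong (sum charge +_) (ℚ.+-identityʳ y) ⟩
          sum charge + y                ∎
          where
          charge-j₀≡0 : charge j₀ ≡ 0ℚ
          charge-j₀≡0 = charge-unused j₀ (unused-partner p)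

      step : Invariant (suc k) wl′ c′
      step with partner i₀ in p
      ... | nothing = step-unmatched p
      ... | just _  = step-matched p

    skip-step : ∀ {wl c} → Invariant k wl c → (∀ j → w i₀ j ≤ τ * wl j) →
                Invariant (suc k) wl c
    skip-step I dominated = step I 0ℚ ℚ.≤-refl (sym (ℚ.+-identityʳ _)) (λ _ → ℚ.≤-refl)
      (λ j → subst (w i₀ j ≤_) (sym (ℚ.+-identityʳ _)) (dominated j))

    match-step : ∀ {wl c} → Invariant k wl c → (j* : Fin n) →
                 (∃ λ j → τ * wl j <ℚ w i₀ j) →
                 (∀ j → w i₀ j - τ * wl j ≤ w i₀ j* - τ * wl j*) →
                 Invariant (suc k) (update wl j* (w i₀ j*)) (c + f * wl j*)
    match-step {wl} {c} I j* (j , τ*wl<w) maximal =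
      step I gain 0≤gain potential-match τ*wl-mono edges-covered
      where
      x a gain : ℚ
      x = w i₀ j*
      a = wl j*
      gain = x - τ * a
      wl′ : Vector ℚ n
      wl′ = update wl j* x

      0≤gain : 0ℚ ≤ gain
      0≤gain = ℚ.≤-trans (p≤q⇒0≤q-p (ℚ.<⇒≤ τ*wl<w)) (maximal j)

      potential-match : potential wl′ (c + f * a) ≡ potential wl c + gain
      potential-match = begin
        sum wl′ - κ * (c + f * a)          ≡⟨ cong (_- κ * (c + f * a)) (sum-update wl j* x) ⟩
        (sum wl + (x - a)) - κ * (c + f * a)
          ≡⟨ solve 6 (λ W x a κ c f → (W :+ (x :- a)) :- κ :* (c :+ f :* a)
                                       := (W :- κ :* c) :+ (x :- (con 1ℚ :+ κ :* f) :* a))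
                     refl (sum wl) x a κ c f ⟩
        potential wl c + gain              ∎
        where open ≡-Reasoning

      τ*wl-mono : ∀ j → τ * wl j ≤ τ * wl′ j
      τ*wl-mono = update-elim (λ j v → τ * wl j ≤ τ * v) wl {j*}
        (ℚ.≤-trans (0≤q-p⇒p≤q 0≤gain) (p≤τ*p (w≥0 i₀ j*))) (λ _ _ → ℚ.≤-refl)

      edges-covered : ∀ j → w i₀ j ≤ τ * wl′ j + gain
      edges-covered j = ℚ.≤-trans (p-q≤r⇒p≤q+r (maximal j)) (ℚ.+-monoˡ-≤ gain (τ*wl-mono j))

  invariant : ∀ {k wl c} → Exec τ f w k wl c → Invariant k wl c
  invariant start                         = initial
  invariant (skip e k<T dominated)        = Step.skip-step _ k<T (invariant e) dominated
  invariant (match e k<T j* improves max) = Step.match-step _ k<T (invariant e) j* improves max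

  competitive-bound : ∀ {wl c} → Exec τ f w T wl c →
                      matchingWeight w M ≤ (1ℚ + τ) * Σℚ n wl - κ * c
  competitive-bound {wl} {c} e = begin
    matchingWeight w M                      ≡⟨ Σℚ≡sum T opt ⟩
    sum opt                                 ≡⟨ sum-prefix-all opt ⟨
    sum (prefix T opt)                      ≤⟨ covers ⟩
    potential wl c + sum charge             ≤⟨ ℚ.+-monoʳ-≤ (potential wl c) (sum-mono-≤ charge≤) ⟩
    potential wl c + sum (λ j → τ * wl j)   ≡⟨ cong (potential wl c +_) (*-distribˡ-sum τ wl) ⟨
    potential wl c + τ * sum wl             ≡⟨ collect (sum wl) κ c τ ⟩
    (1ℚ + τ) * sum wl - κ * c               ≡⟨ cong (λ W → (1ℚ + τ) * W - κ * c) (Σℚ≡sum n wl) ⟨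
    (1ℚ + τ) * Σℚ n wl - κ * c              ∎
    where
    open ℚ.≤-Reasoning
    open Invariant (invariant e)
    collect : ∀ W κ c τ → (W - κ * c) + τ * W ≡ (1ℚ + τ) * W - κ * c
    collect = solve 4 (λ W κ c τ → (W :- κ :* c) :+ τ :* W := (con 1ℚ :+ τ) :* W :- κ :* c) refl

module _ (f : ℚ) (f≤ : f ≤ one-third) where

  private
    instance
      1-f≢0 : NonZero (1ℚ - f)
      1-f≢0 = 1-f-nonZero f f≤

    e : ℚ
    e = 1/ (1ℚ - f)

    [1-f]*e≡1 : (1ℚ - f) * e ≡ 1ℚ
    [1-f]*e≡1 = ℚ.*-inverseʳ (1ℚ - f)

  penalty≡1+ratio*f : penalty f f≤ ≡ 1ℚ + ratio f f≤ * f
  penalty≡1+ratio*f = begin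
    (1ℚ + f) * e                   ≡⟨ split f e ⟩
    (1ℚ - f) * e + ratio f f≤ * f  ≡⟨ cong (_+ ratio f f≤ * f) [1-f]*e≡1 ⟩
    1ℚ + ratio f f≤ * f            ∎
    where
    open ≡-Reasoning
    split : ∀ f e → (1ℚ + f) * e ≡ (1ℚ - f) * e + (1ℚ + 1ℚ) * e * f
    split = solve 2 (λ f e → (con 1ℚ :+ f) :* e
                             := (con 1ℚ :- f) :* e :+ (con 1ℚ :+ con 1ℚ) :* e :* f) refl

  ratio≡1+penalty : ratio f f≤ ≡ 1ℚ + penalty f f≤
  ratio≡1+penalty = begin
    (1ℚ + 1ℚ) * e                ≡⟨ split f e ⟩
    (1ℚ - f) * e + penalty f f≤  ≡⟨ cong (_+ penalty f f≤) [1-f]*e≡1 ⟩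
    1ℚ + penalty f f≤            ∎
    where
    open ≡-Reasoning
    split : ∀ f e → (1ℚ + 1ℚ) * e ≡ (1ℚ - f) * e + (1ℚ + f) * e
    split = solve 2 (λ f e → (con 1ℚ :+ con 1ℚ) :* e := (con 1ℚ :- f) :* e :+ (con 1ℚ :+ f) :* e) refl

  0≤ratio : 0ℚ ≤ ratio f f≤
  0≤ratio = ℚ.<⇒≤ (ℚ.positive⁻¹ (ratio f f≤)
    {{ℚ.pos*pos⇒pos (1ℚ + 1ℚ) e {{ℚ.1/pos⇒pos (1ℚ - f) {{positive (1-f>0 f f≤)}}}}}})

corollary3 : (f : ℚ) → 0ℚ ≤ f → (f≤ : f ≤ one-third) →
    (T n : ℕ) (w : Weights T n) → NonNegWeights w →
    (wl : Fin n → ℚ) (c : ℚ) → Exec (penalty f f≤) f w T wl c →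
    (M : Matching T n) →
    matchingWeight w M ≤ ratio f f≤ * profit wl c
corollary3 f 0≤f f≤ T n w w≥0 wl c e M = begin
  matchingWeight w M              ≤⟨ competitive-bound (subst (λ τ → Exec τ f w T wl c) penalty≡ e) ⟩
  (1ℚ + τ) * Σℚ n wl - κ * c      ≡⟨ cong (λ r → r * Σℚ n wl - κ * c) κ≡1+τ ⟨
  κ * Σℚ n wl - κ * c             ≡⟨ factor κ (Σℚ n wl) c ⟩
  κ * profit wl c                 ∎
  where
  open ℚ.≤-Reasoning
  κ : ℚ
  κ = ratio f f≤
  open Analysis κ f (0≤p*q (0≤ratio f f≤) 0≤f) w w≥0 M using (τ; competitive-bound)
  penalty≡ : penalty f f≤ ≡ τ
  penalty≡ = penalty≡1+ratio*f f f≤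
  κ≡1+τ : κ ≡ 1ℚ + τ
  κ≡1+τ = trans (ratio≡1+penalty f f≤) (cong (1ℚ +_) penalty≡)
  factor : ∀ κ W c → κ * W - κ * c ≡ κ * (W - c)
  factor = solve 3 (λ κ W c → κ :* W :- κ :* c := κ :* (W :- c)) refl
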